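{- Let $a,b,N$ be positive integers such that both $a$ and $b$ are relatively prime with $N$. Then $\mathrm{vrm}(|\Gamma(a,b,N)|)$ is a finite axial subset of $\mathbb R^3_{\ge0}$ in general position.
   Context: $\Gamma(a,b,N)=\{m_1(1,a,b)+m_2(0,N,0)+m_3(0,0,N):m_i\in\mathbb Z\}$ and $|\Gamma|=\{(|x_1|,|x_2|,|x_3|):(x_1,x_2,x_3)\in\Gamma\}\setminus\{0\}$. For $\gamma\in\mathbb R^3_{\ge0}$, $\Pi(\{\gamma\})=\{x:0\le x_i\le\gamma_i\}$; $\gamma\in S$ is a Voronoi relative minimum of $S$ if $\Pi(\{\gamma\})\cap S=\{\gamma\}$, and $\mathrm{vrm}(S)$ is the set of these. A set $S\subset\mathbb R^3_{\ge0}$ is axial if it contains points on each coordinate axis; an axial set is in general position if each coordinate plane contains exactly $2$ points of $S$, none at the origin and lying on different coordinate axes, and every other plane parallel to a coordinate plane contains at most one point of $S$. -}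

module Defs where

open import Data.Nat using (ℕ; zero; suc; _≤_; _<_)
open import Data.Integer using (ℤ; +_; ∣_∣) renaming (_+_ to _+ℤ_; _*_ to _*ℤ_)
open import Data.Product using (Σ; ∃; _×_; _,_)
open import Data.Sum using (_⊎_)
open import Data.List using (List)
open import Data.List.Membership.Propositional using (_∈_)
open import Relation.Binary.PropositionalEquality using (_≡_; _≢_)

-- points of ℤ³ and of ℕ³ (= ℤ³ ∩ ℝ³_{≥0})
ℤ³ : Set
ℤ³ = ℤ × ℤ × ℤ

ℕ³ : Set
ℕ³ = ℕ × ℕ × ℕ

Γ : ℕ → ℕ → ℕ → ℤ³ → Set
Γ a b N x = Σ ℤ λ m₁ → Σ ℤ λ m₂ → Σ ℤ λ m₃ →
  x ≡ (m₁ , (m₁ *ℤ + a) +ℤ (m₂ *ℤ + N) , (m₁ *ℤ + b) +ℤ (m₃ *ℤ + N))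

absV : ℤ³ → ℕ³
absV (x₁ , x₂ , x₃) = (∣ x₁ ∣ , ∣ x₂ ∣ , ∣ x₃ ∣)

origin : ℕ³
origin = (0 , 0 , 0)

absΓ : ℕ → ℕ → ℕ → ℕ³ → Set
absΓ a b N γ = (Σ ℤ³ λ x → Γ a b N x × absV x ≡ γ) × γ ≢ origin

_∈Π_ : ℕ³ → ℕ³ → Set
(x₁ , x₂ , x₃) ∈Π (γ₁ , γ₂ , γ₃) = x₁ ≤ γ₁ × x₂ ≤ γ₂ × x₃ ≤ γ₃

vrm : (ℕ³ → Set) → ℕ³ → Set
vrm S γ = S γ × (∀ x → S x → x ∈Π γ → x ≡ γ)

Finite : (ℕ³ → Set) → Set
Finite S = Σ (List ℕ³) λ L → ∀ γ → (S γ → γ ∈ L) × (γ ∈ L → S γ)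

Axial : (ℕ³ → Set) → Set
Axial S = (Σ ℕ λ p → S (p , 0 , 0)) × (Σ ℕ λ p → S (0 , p , 0)) × (Σ ℕ λ p → S (0 , 0 , p))

c₁ c₂ c₃ : ℕ³ → ℕ
c₁ (x , _ , _) = x
c₂ (_ , y , _) = y
c₃ (_ , _ , z) = z

TwoAxisPoints : (ℕ³ → Set) → (ℕ³ → ℕ) → (ℕ → ℕ³) → (ℕ → ℕ³) → Set
TwoAxisPoints S c e f = Σ ℕ λ p → Σ ℕ λ q →
  0 < p × 0 < q × S (e p) × S (f q) ×
  (∀ x → S x → c x ≡ 0 → x ≡ e p ⊎ x ≡ f q)

-- every other plane parallel to {xᵢ = 0}, i.e. {xᵢ = t} with t > 0, contains at most one point
-- (planes {xᵢ = t} with t non-integral contain no point of S ⊆ ℕ³)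
AtMostOne : (ℕ³ → Set) → (ℕ³ → ℕ) → Set
AtMostOne S c = ∀ t → 0 < t → ∀ x y → S x → S y → c x ≡ t → c y ≡ t → x ≡ y

GeneralPosition : (ℕ³ → Set) → Set
GeneralPosition S =
  Axial S ×
  TwoAxisPoints S c₁ (λ p → (0 , p , 0)) (λ q → (0 , 0 , q)) ×
  TwoAxisPoints S c₂ (λ p → (p , 0 , 0)) (λ q → (0 , 0 , q)) ×
  TwoAxisPoints S c₃ (λ p → (p , 0 , 0)) (λ q → (0 , q , 0)) ×
  AtMostOne S c₁ × AtMostOne S c₂ × AtMostOne S c₃

{-# OPTIONS --safe #-}
-- Γ(a,b,N) is the set of integer vectors with x₂ ≡ a x₁ and x₃ ≡ b x₁ (mod N). Since a and b
-- are units mod N, one coordinate of a lattice point determines its whole class mod N: if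
-- it vanishes mod N, the point lies in N ℤ³. Hence two points of |Γ| sharing a positive
-- coordinate lift, after a sign change, to congruent lattice points, and choosing in each
-- coordinate the entry of smaller absolute value yields a lattice point whose absolute value
-- is the componentwise minimum. Two Voronoi minima can never have such a common lower bound
-- in |Γ|, so every plane {xᵢ = t}, t > 0, holds at most one of them. A point of |Γ| in a
-- coordinate plane lies in N ℕ³, so it dominates some axis point N eⱼ; therefore the N eⱼ
-- are the only minima in the coordinate planes, and they bound every minimum, so all
-- minima lie in the box [0,N]³.
module Submission where

open import Defs
open import Data.Nat using (ℕ; _<_)
open import Data.Nat.Coprimality using (Coprime)
open import Data.Product using (_×_)

open import Data.Nat using (suc; _≤_; _⊓_; z≤n; s≤s)
import Data.Nat.Properties as ℕP
import Data.Nat.Divisibility as ℕD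
import Data.Nat.Coprimality as ℕC
open import Data.Integer using (ℤ; +_; -_; ∣_∣; +0; -[1+_])
  renaming (_+_ to _+ℤ_; _*_ to _*ℤ_; _-_ to _-ℤ_)
import Data.Integer.Properties as ℤP
import Data.Integer.Divisibility.Signed as ℤD
import Data.Integer.Coprimality as ℤC
open import Data.Integer.Tactic.RingSolver using (solve-∀)
open import Data.Product using (Σ; ∃-syntax; _,_; proj₁; proj₂)
import Data.Product.Properties as ×P
open import Data.Sum using (_⊎_; inj₁; inj₂)
import Data.Sum as Sum
open import Data.Empty using (⊥-elim)
open import Data.List using (List; upTo; cartesianProduct; filter)
open import Data.List.Membership.Propositional using (_∈_)
import Data.List.Membership.Propositional.Properties as ∈P
import Data.List.Relation.Unary.All as All
open import Relation.Nullary using (Dec; yes; no; ¬_; contradiction)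
open import Relation.Nullary.Decidable using (_×-dec_; _→-dec_; _⊎-dec_; map′; ¬?)
open import Relation.Unary using (Decidable)
open import Relation.Binary.PropositionalEquality
  using (_≡_; _≢_; refl; sym; trans; cong; cong₂; subst; module ≡-Reasoning)

_≟³_ : (x y : ℕ³) → Dec (x ≡ y)
_≟³_ = ×P.≡-dec ℕP._≟_ (×P.≡-dec ℕP._≟_ ℕP._≟_)

_⊓³_ : ℕ³ → ℕ³ → ℕ³
(x₁ , x₂ , x₃) ⊓³ (y₁ , y₂ , y₃) = (x₁ ⊓ y₁ , x₂ ⊓ y₂ , x₃ ⊓ y₃)

⊓³-∈Πˡ : ∀ x y → (x ⊓³ y) ∈Π x
⊓³-∈Πˡ _ _ = ℕP.m⊓n≤m _ _ , ℕP.m⊓n≤m _ _ , ℕP.m⊓n≤m _ _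

⊓³-∈Πʳ : ∀ x y → (x ⊓³ y) ∈Π y
⊓³-∈Πʳ _ _ = ℕP.m⊓n≤n _ _ , ℕP.m⊓n≤n _ _ , ℕP.m⊓n≤n _ _

vrm-⊓³⇒≡ : ∀ {S x y} → vrm S x → vrm S y → S (x ⊓³ y) → x ≡ y
vrm-⊓³⇒≡ {x = x} {y} (_ , x-minimal) (_ , y-minimal) x⊓y∈S =
  trans (sym (x-minimal _ x⊓y∈S (⊓³-∈Πˡ x y))) (y-minimal _ x⊓y∈S (⊓³-∈Πʳ x y))

box : ℕ³ → List ℕ³
box (γ₁ , γ₂ , γ₃) =
  cartesianProduct (upTo (suc γ₁)) (cartesianProduct (upTo (suc γ₂)) (upTo (suc γ₃)))

∈-box⁺ : ∀ {x γ} → x ∈Π γ → x ∈ box γ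
∈-box⁺ (x₁≤ , x₂≤ , x₃≤) =
  ∈P.∈-cartesianProduct⁺ (∈P.∈-upTo⁺ (s≤s x₁≤))
    (∈P.∈-cartesianProduct⁺ (∈P.∈-upTo⁺ (s≤s x₂≤)) (∈P.∈-upTo⁺ (s≤s x₃≤)))

∈-box⁻ : ∀ {x γ} → x ∈ box γ → x ∈Π γ
∈-box⁻ x∈box with ∈P.∈-cartesianProduct⁻ _ _ x∈box
... | x₁∈ , x₂₃∈ with ∈P.∈-cartesianProduct⁻ _ _ x₂₃∈
... | x₂∈ , x₃∈ =
  ℕP.≤-pred (∈P.∈-upTo⁻ x₁∈) , ℕP.≤-pred (∈P.∈-upTo⁻ x₂∈) , ℕP.≤-pred (∈P.∈-upTo⁻ x₃∈)

vrm? : ∀ {S} → Decidable S → Decidable (vrm S)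
vrm? {S} S? γ =
  map′ fromBox toBox (S? γ ×-dec All.all? (λ x → S? x →-dec (x ≟³ γ)) (box γ))
  where
  fromBox : S γ × All.All (λ x → S x → x ≡ γ) (box γ) → vrm S γ
  fromBox (γ∈S , below) = γ∈S , λ x x∈S x≤γ → All.lookup below (∈-box⁺ x≤γ) x∈S
  toBox : vrm S γ → S γ × All.All (λ x → S x → x ≡ γ) (box γ)
  toBox (γ∈S , minimal) = γ∈S , All.tabulate λ x∈box x∈S → minimal _ x∈S (∈-box⁻ x∈box)

vrm-finite : ∀ {S} β → Decidable S → (∀ γ → vrm S γ → γ ∈Π β) → Finite (vrm S)
vrm-finite β S? bounded =
  filter (vrm? S?) (box β) ,
  λ γ → (λ γ∈vrm → ∈P.∈-filter⁺ (vrm? S?) (∈-box⁺ (bounded γ γ∈vrm)) γ∈vrm) ,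
        (λ γ∈list → proj₂ (∈P.∈-filter⁻ (vrm? S?) γ∈list))

data Axis : Set where
  ax₁ ax₂ ax₃ : Axis

_≟ᵃ_ : (i j : Axis) → Dec (i ≡ j)
ax₁ ≟ᵃ ax₁ = yes refl
ax₁ ≟ᵃ ax₂ = no λ ()
ax₁ ≟ᵃ ax₃ = no λ ()
ax₂ ≟ᵃ ax₁ = no λ ()
ax₂ ≟ᵃ ax₂ = yes refl
ax₂ ≟ᵃ ax₃ = no λ ()
ax₃ ≟ᵃ ax₁ = no λ ()
ax₃ ≟ᵃ ax₂ = no λ ()
ax₃ ≟ᵃ ax₃ = yes refl

otherAxes : Axis → Axis × Axis
otherAxes ax₁ = ax₂ , ax₃
otherAxes ax₂ = ax₁ , ax₃
otherAxes ax₃ = ax₁ , ax₂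

otherAxes-complete : ∀ {i j} → j ≢ i → j ≡ proj₁ (otherAxes i) ⊎ j ≡ proj₂ (otherAxes i)
otherAxes-complete {ax₁} {ax₁} j≢i = ⊥-elim (j≢i refl)
otherAxes-complete {ax₁} {ax₂} _ = inj₁ refl
otherAxes-complete {ax₁} {ax₃} _ = inj₂ refl
otherAxes-complete {ax₂} {ax₁} _ = inj₁ refl
otherAxes-complete {ax₂} {ax₂} j≢i = ⊥-elim (j≢i refl)
otherAxes-complete {ax₂} {ax₃} _ = inj₂ refl
otherAxes-complete {ax₃} {ax₁} _ = inj₁ refl
otherAxes-complete {ax₃} {ax₂} _ = inj₂ refl
otherAxes-complete {ax₃} {ax₃} j≢i = ⊥-elim (j≢i refl)

otherAxes-≢ : ∀ i → proj₁ (otherAxes i) ≢ i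
otherAxes-≢ ax₁ ()
otherAxes-≢ ax₂ ()
otherAxes-≢ ax₃ ()

coord : Axis → ℕ³ → ℕ
coord ax₁ = c₁
coord ax₂ = c₂
coord ax₃ = c₃

onAxis : Axis → ℕ → ℕ³
onAxis ax₁ p = (p , 0 , 0)
onAxis ax₂ p = (0 , p , 0)
onAxis ax₃ p = (0 , 0 , p)

≡-byCoord : ∀ {x y} → (∀ i → coord i x ≡ coord i y) → x ≡ y
≡-byCoord eq = cong₂ _,_ (eq ax₁) (cong₂ _,_ (eq ax₂) (eq ax₃))

coord-∈Π : ∀ i {x y} → x ∈Π y → coord i x ≤ coord i y
coord-∈Π ax₁ (x₁≤ , _ , _) = x₁≤
coord-∈Π ax₂ (_ , x₂≤ , _) = x₂≤
coord-∈Π ax₃ (_ , _ , x₃≤) = x₃≤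

coord-origin : ∀ i → coord i origin ≡ 0
coord-origin ax₁ = refl
coord-origin ax₂ = refl
coord-origin ax₃ = refl

coord-⊓³ : ∀ i x y → coord i (x ⊓³ y) ≡ coord i x ⊓ coord i y
coord-⊓³ ax₁ _ _ = refl
coord-⊓³ ax₂ _ _ = refl
coord-⊓³ ax₃ _ _ = refl

coord-onAxis : ∀ i p → coord i (onAxis i p) ≡ p
coord-onAxis ax₁ p = refl
coord-onAxis ax₂ p = refl
coord-onAxis ax₃ p = refl

coord-onAxis-≢ : ∀ {i j} p → j ≢ i → coord j (onAxis i p) ≡ 0
coord-onAxis-≢ {i} {j} p j≢i with otherAxes-complete j≢i
coord-onAxis-≢ {ax₁} p _ | inj₁ refl = refl
coord-onAxis-≢ {ax₁} p _ | inj₂ refl = refl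
coord-onAxis-≢ {ax₂} p _ | inj₁ refl = refl
coord-onAxis-≢ {ax₂} p _ | inj₂ refl = refl
coord-onAxis-≢ {ax₃} p _ | inj₁ refl = refl
coord-onAxis-≢ {ax₃} p _ | inj₂ refl = refl

onAxis-∈Π : ∀ i {p x} → p ≤ coord i x → onAxis i p ∈Π x
onAxis-∈Π ax₁ p≤ = p≤ , z≤n , z≤n
onAxis-∈Π ax₂ p≤ = z≤n , p≤ , z≤n
onAxis-∈Π ax₃ p≤ = z≤n , z≤n , p≤

positiveCoord : ∀ x → x ≢ origin → ∃[ i ] 0 < coord i x
positiveCoord (suc _ , _ , _) _ = ax₁ , s≤s z≤n
positiveCoord (0 , suc _ , _) _ = ax₂ , s≤s z≤n
positiveCoord (0 , 0 , suc _) _ = ax₃ , s≤s z≤n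
positiveCoord (0 , 0 , 0) x≢0 = ⊥-elim (x≢0 refl)

⊓³-≢origin : ∀ i {x y} → 0 < coord i x → coord i x ≡ coord i y → x ⊓³ y ≢ origin
⊓³-≢origin i {x} {y} 0<xᵢ xᵢ≡yᵢ x⊓y≡0 = ℕP.<⇒≢ 0<xᵢ (sym xᵢ≡0)
  where
  open ≡-Reasoning
  xᵢ≡0 : coord i x ≡ 0
  xᵢ≡0 = begin
    coord i x                ≡⟨ ℕP.⊓-idem (coord i x) ⟨
    coord i x ⊓ coord i x    ≡⟨ cong (coord i x ⊓_) xᵢ≡yᵢ ⟩
    coord i x ⊓ coord i y    ≡⟨ coord-⊓³ i x y ⟨
    coord i (x ⊓³ y)         ≡⟨ cong (coord i) x⊓y≡0 ⟩
    coord i origin           ≡⟨ coord-origin i ⟩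
    0                        ∎

module AxialMinima
  (S : ℕ³ → Set) (N : ℕ) (0<N : 0 < N)
  (origin∉S : ¬ S origin)
  (onAxis∈S : ∀ i → S (onAxis i N))
  (inPlane⇒N∣ : ∀ i {x} → S x → coord i x ≡ 0 → ∀ j → N ℕD.∣ coord j x)
  (⊓³∈S : ∀ i {x y} → S x → S y → 0 < coord i x → coord i x ≡ coord i y → S (x ⊓³ y))
  (S? : Decidable S)
  where

  private
    N∣⇒N≤ : ∀ {n} → N ℕD.∣ n → 0 < n → N ≤ n
    N∣⇒N≤ {suc _} N∣n _ = ℕD.∣⇒≤ N∣n

    S⇒≢origin : ∀ {x} → S x → x ≢ origin
    S⇒≢origin x∈S refl = origin∉S x∈S

  onAxis∈vrm : ∀ i → vrm S (onAxis i N)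
  onAxis∈vrm i = onAxis∈S i , minimal
    where
    minimal : ∀ y → S y → y ∈Π onAxis i N → y ≡ onAxis i N
    minimal y y∈S y≤ = ≡-byCoord coordwise
      where
      offAxis : ∀ {j} → j ≢ i → coord j y ≡ 0
      offAxis {j} j≢i =
        ℕP.n≤0⇒n≡0 (subst (coord j y ≤_) (coord-onAxis-≢ N j≢i) (coord-∈Π j y≤))
      N∣y : ∀ j → N ℕD.∣ coord j y
      N∣y = inPlane⇒N∣ (proj₁ (otherAxes i)) y∈S (offAxis (otherAxes-≢ i))
      onAxisCoord : coord i y ≡ N
      onAxisCoord with positiveCoord y (S⇒≢origin y∈S)
      ... | j , 0<yⱼ with j ≟ᵃ i
      ... | no j≢i = contradiction (sym (offAxis j≢i)) (ℕP.<⇒≢ 0<yⱼ)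
      ... | yes refl = ℕP.≤-antisym
        (subst (coord i y ≤_) (coord-onAxis i N) (coord-∈Π i y≤)) (N∣⇒N≤ (N∣y i) 0<yⱼ)
      coordwise : ∀ j → coord j y ≡ coord j (onAxis i N)
      coordwise j with j ≟ᵃ i
      ... | yes refl = trans onAxisCoord (sym (coord-onAxis i N))
      ... | no j≢i = trans (offAxis j≢i) (sym (coord-onAxis-≢ N j≢i))

  vrm-inPlane : ∀ i {x} → vrm S x → coord i x ≡ 0 → ∃[ j ] j ≢ i × x ≡ onAxis j N
  vrm-inPlane i {x} (x∈S , minimal) xᵢ≡0 with positiveCoord x (S⇒≢origin x∈S)
  ... | j , 0<xⱼ = j , j≢i , sym (minimal _ (onAxis∈S j) (onAxis-∈Π j N≤xⱼ))
    where
    j≢i : j ≢ i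
    j≢i refl = ℕP.<⇒≢ 0<xⱼ (sym xᵢ≡0)
    N≤xⱼ : N ≤ coord j x
    N≤xⱼ = N∣⇒N≤ (inPlane⇒N∣ i x∈S xᵢ≡0 j) 0<xⱼ

  vrm-coord≤N : ∀ i {γ} → vrm S γ → coord i γ ≤ N
  vrm-coord≤N i {γ} (_ , minimal) with ℕP.≤-total (coord i γ) N
  ... | inj₁ γᵢ≤N = γᵢ≤N
  ... | inj₂ N≤γᵢ = ℕP.≤-reflexive (trans (cong (coord i) (sym Nᵢ≡γ)) (coord-onAxis i N))
    where Nᵢ≡γ = minimal _ (onAxis∈S i) (onAxis-∈Π i N≤γᵢ)

  twoAxisPoints : ∀ i →
    TwoAxisPoints (vrm S) (coord i) (onAxis (proj₁ (otherAxes i))) (onAxis (proj₂ (otherAxes i)))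
  twoAxisPoints i = N , N , 0<N , 0<N , onAxis∈vrm _ , onAxis∈vrm _ , onPlane
    where
    onPlane : ∀ x → vrm S x → coord i x ≡ 0 →
              x ≡ onAxis (proj₁ (otherAxes i)) N ⊎ x ≡ onAxis (proj₂ (otherAxes i)) N
    onPlane x x∈vrm xᵢ≡0 with vrm-inPlane i x∈vrm xᵢ≡0
    ... | j , j≢i , refl =
      Sum.map (cong (λ k → onAxis k N)) (cong (λ k → onAxis k N)) (otherAxes-complete j≢i)

  atMostOne : ∀ i → AtMostOne (vrm S) (coord i)
  atMostOne i t 0<t x y x∈vrm y∈vrm xᵢ≡t yᵢ≡t = vrm-⊓³⇒≡ x∈vrm y∈vrm
    (⊓³∈S i (proj₁ x∈vrm) (proj₁ y∈vrm) (subst (0 <_) (sym xᵢ≡t) 0<t) (trans xᵢ≡t (sym yᵢ≡t)))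

  finite : Finite (vrm S)
  finite = vrm-finite (N , N , N) S? λ _ γ∈vrm →
    vrm-coord≤N ax₁ γ∈vrm , vrm-coord≤N ax₂ γ∈vrm , vrm-coord≤N ax₃ γ∈vrm

  axial : Axial (vrm S)
  axial = (N , onAxis∈vrm ax₁) , (N , onAxis∈vrm ax₂) , (N , onAxis∈vrm ax₃)

  generalPosition : GeneralPosition (vrm S)
  generalPosition =
    axial , twoAxisPoints ax₁ , twoAxisPoints ax₂ , twoAxisPoints ax₃ ,
    atMostOne ax₁ , atMostOne ax₂ , atMostOne ax₃

coordℤ : Axis → ℤ³ → ℤ
coordℤ ax₁ (x₁ , _ , _) = x₁
coordℤ ax₂ (_ , x₂ , _) = x₂
coordℤ ax₃ (_ , _ , x₃) = x₃

coord-absV : ∀ i X → coord i (absV X) ≡ ∣ coordℤ i X ∣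
coord-absV ax₁ _ = refl
coord-absV ax₂ _ = refl
coord-absV ax₃ _ = refl

toℤ³ : ℕ³ → ℤ³
toℤ³ (x₁ , x₂ , x₃) = (+ x₁ , + x₂ , + x₃)

coordℤ-toℤ³ : ∀ i x → coordℤ i (toℤ³ x) ≡ + coord i x
coordℤ-toℤ³ ax₁ _ = refl
coordℤ-toℤ³ ax₂ _ = refl
coordℤ-toℤ³ ax₃ _ = refl

neg³ : ℤ³ → ℤ³
neg³ (x₁ , x₂ , x₃) = (- x₁ , - x₂ , - x₃)

coordℤ-neg³ : ∀ i X → coordℤ i (neg³ X) ≡ - coordℤ i X
coordℤ-neg³ ax₁ _ = refl
coordℤ-neg³ ax₂ _ = refl
coordℤ-neg³ ax₃ _ = refl

absV-neg³ : ∀ X → absV (neg³ X) ≡ absV X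
absV-neg³ (x₁ , x₂ , x₃) =
  cong₂ _,_ (ℤP.∣-i∣≡∣i∣ x₁) (cong₂ _,_ (ℤP.∣-i∣≡∣i∣ x₂) (ℤP.∣-i∣≡∣i∣ x₃))

zipWith³ : (ℤ → ℤ → ℤ) → ℤ³ → ℤ³ → ℤ³
zipWith³ f (x₁ , x₂ , x₃) (y₁ , y₂ , y₃) = (f x₁ y₁ , f x₂ y₂ , f x₃ y₃)

coordℤ-zipWith³ : ∀ i f X Y → coordℤ i (zipWith³ f X Y) ≡ f (coordℤ i X) (coordℤ i Y)
coordℤ-zipWith³ ax₁ _ _ _ = refl
coordℤ-zipWith³ ax₂ _ _ _ = refl
coordℤ-zipWith³ ax₃ _ _ _ = refl

∣i∣≡∣j∣⇒i≡±j : ∀ i j → ∣ i ∣ ≡ ∣ j ∣ → i ≡ j ⊎ i ≡ - j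
∣i∣≡∣j∣⇒i≡±j (+ m) (+ .m) refl = inj₁ refl
∣i∣≡∣j∣⇒i≡±j (+ .(suc n)) -[1+ n ] refl = inj₂ refl
∣i∣≡∣j∣⇒i≡±j -[1+ m ] (+ .(suc m)) refl = inj₂ refl
∣i∣≡∣j∣⇒i≡±j -[1+ m ] -[1+ .m ] refl = inj₁ refl

abs-preimage? : (P : ℤ → Set) → Decidable P → ∀ n → Dec (∃[ x ] ∣ x ∣ ≡ n × P x)
abs-preimage? P P? n = map′ fromSigned toSigned (P? (+ n) ⊎-dec P? (- + n))
  where
  fromSigned : P (+ n) ⊎ P (- + n) → ∃[ x ] ∣ x ∣ ≡ n × P x
  fromSigned (inj₁ P+n) = + n , refl , P+n
  fromSigned (inj₂ P-n) = - + n , ℤP.∣-i∣≡∣i∣ (+ n) , P-n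
  toSigned : ∃[ x ] ∣ x ∣ ≡ n × P x → P (+ n) ⊎ P (- + n)
  toSigned (x , refl , Px) =
    Sum.map (λ x≡ → subst P x≡ Px) (λ x≡ → subst P x≡ Px) (∣i∣≡∣j∣⇒i≡±j x (+ ∣ x ∣) refl)

minAbs : ℤ → ℤ → ℤ
minAbs u v with ∣ u ∣ ℕP.≤? ∣ v ∣
... | yes _ = u
... | no _ = v

∣minAbs∣ : ∀ u v → ∣ minAbs u v ∣ ≡ ∣ u ∣ ⊓ ∣ v ∣
∣minAbs∣ u v with ∣ u ∣ ℕP.≤? ∣ v ∣
... | yes u≤v = sym (ℕP.m≤n⇒m⊓n≡m u≤v)
... | no u≰v = sym (ℕP.m≥n⇒m⊓n≡n (ℕP.≰⇒≥ u≰v))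

minAbs-choice : ∀ u v → minAbs u v ≡ u ⊎ minAbs u v ≡ v
minAbs-choice u v with ∣ u ∣ ℕP.≤? ∣ v ∣
... | yes _ = inj₁ refl
... | no _ = inj₂ refl

absV-zipWith³-minAbs : ∀ X Y → absV (zipWith³ minAbs X Y) ≡ absV X ⊓³ absV Y
absV-zipWith³-minAbs (x₁ , x₂ , x₃) (y₁ , y₂ , y₃) =
  cong₂ _,_ (∣minAbs∣ x₁ y₁) (cong₂ _,_ (∣minAbs∣ x₂ y₂) (∣minAbs∣ x₃ y₃))

module AbsLattice (a b N : ℕ) (a⊥N : Coprime a N) (b⊥N : Coprime b N) where

  N∣_ : ℤ → Set
  N∣ z = + N ℤD.∣ z

  N∣0 : N∣ +0
  N∣0 = ℤD.divides +0 (sym (ℤP.*-zeroˡ (+ N)))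

  N∣i-i : ∀ i → N∣ (i -ℤ i)
  N∣i-i i = subst N∣_ (sym (ℤP.+-inverseʳ i)) N∣0

  -- y ≡ c x (mod N). This and InΓ are records, not definitions, so that their
  -- integer arguments can be inferred from a proof.
  record Lin (c : ℕ) (x y : ℤ) : Set where
    constructor lin
    field N∣y-cx : N∣ (y -ℤ x *ℤ + c)

  Lin-neg : ∀ c {x y} → Lin c x y → Lin c (- x) (- y)
  Lin-neg c {x} {y} (lin Lxy) = lin (subst N∣_ (identity x y (+ c)) (ℤD.∣m⇒∣-m Lxy))
    where
    identity : ∀ x y c → - (y -ℤ x *ℤ c) ≡ - y -ℤ (- x) *ℤ c
    identity = solve-∀

  Lin-sub : ∀ c {x y x′ y′} → Lin c x y → Lin c x′ y′ → Lin c (x -ℤ x′) (y -ℤ y′)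
  Lin-sub c {x} {y} {x′} {y′} (lin Lxy) (lin Lx′y′) =
    lin (subst N∣_ (identity x y x′ y′ (+ c)) (ℤD.∣m∣n⇒∣m-n Lxy Lx′y′))
    where
    identity : ∀ x y x′ y′ c → (y -ℤ x *ℤ c) -ℤ (y′ -ℤ x′ *ℤ c) ≡ (y -ℤ y′) -ℤ (x -ℤ x′) *ℤ c
    identity = solve-∀

  Lin-shift : ∀ c {x y u v} → Lin c x y → N∣ (u -ℤ x) → N∣ (v -ℤ y) → Lin c u v
  Lin-shift c {x} {y} {u} {v} (lin Lxy) N∣u-x N∣v-y =
    lin (subst N∣_ (identity x y u v (+ c))
      (ℤD.∣m∣n⇒∣m+n Lxy (ℤD.∣m∣n⇒∣m-n N∣v-y (ℤD.∣m⇒∣m*n (+ c) N∣u-x))))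
    where
    identity : ∀ x y u v c → (y -ℤ x *ℤ c) +ℤ ((v -ℤ y) -ℤ (u -ℤ x) *ℤ c) ≡ v -ℤ u *ℤ c
    identity = solve-∀

  Lin-N∣ : ∀ c {x y} → Lin c x y → N∣ x → N∣ y
  Lin-N∣ c {x} {y} (lin Lxy) N∣x =
    subst N∣_ (identity x y (+ c)) (ℤD.∣m∣n⇒∣m+n Lxy (ℤD.∣m⇒∣m*n (+ c) N∣x))
    where
    identity : ∀ x y c → (y -ℤ x *ℤ c) +ℤ x *ℤ c ≡ y
    identity = solve-∀

  Lin-N∣-N∣ : ∀ c {x y} → N∣ x → N∣ y → Lin c x y
  Lin-N∣-N∣ c N∣x N∣y = lin (ℤD.∣m∣n⇒∣m-n N∣y (ℤD.∣m⇒∣m*n (+ c) N∣x))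

  Lin-coprime : ∀ {c x y} → Coprime c N → Lin c x y → N∣ y → N∣ x
  Lin-coprime {c} {x} {y} c⊥N (lin Lxy) N∣y = ℤD.∣ᵤ⇒∣
    (ℤC.coprime-divisor (+ N) (+ c) x (ℕC.sym c⊥N)
      (ℤD.∣⇒∣ᵤ (subst N∣_ (identity x y (+ c)) (ℤD.∣m∣n⇒∣m-n N∣y Lxy))))
    where
    identity : ∀ x y c → y -ℤ (y -ℤ x *ℤ c) ≡ c *ℤ x
    identity = solve-∀

  record InΓ (X : ℤ³) : Set where
    constructor inΓ
    field
      lin₂ : Lin a (coordℤ ax₁ X) (coordℤ ax₂ X)
      lin₃ : Lin b (coordℤ ax₁ X) (coordℤ ax₃ X)

  Γ⇒InΓ : ∀ {X} → Γ a b N X → InΓ X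
  Γ⇒InΓ (m₁ , m₂ , m₃ , refl) =
    inΓ (lin (ℤD.divides m₂ (identity m₁ m₂ (+ a) (+ N))))
        (lin (ℤD.divides m₃ (identity m₁ m₃ (+ b) (+ N))))
    where
    identity : ∀ m₁ m c n → (m₁ *ℤ c +ℤ m *ℤ n) -ℤ m₁ *ℤ c ≡ m *ℤ n
    identity = solve-∀

  InΓ⇒Γ : ∀ {X} → InΓ X → Γ a b N X
  InΓ⇒Γ {x₁ , x₂ , x₃} (inΓ (lin (ℤD.divides q₂ eq₂)) (lin (ℤD.divides q₃ eq₃))) =
    x₁ , q₂ , q₃ , cong₂ _,_ refl (cong₂ _,_ (solveFor eq₂) (solveFor eq₃))
    where
    identity : ∀ y z → y ≡ z +ℤ (y -ℤ z)
    identity = solve-∀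
    solveFor : ∀ {y z w} → y -ℤ z ≡ w → y ≡ z +ℤ w
    solveFor {y} {z} eq = trans (identity y z) (cong (z +ℤ_) eq)

  InΓ? : Decidable InΓ
  InΓ? _ = map′ (λ (L₂ , L₃) → inΓ (lin L₂) (lin L₃)) (λ (inΓ (lin L₂) (lin L₃)) → L₂ , L₃)
    ((+ N ℤD.∣? _) ×-dec (+ N ℤD.∣? _))

  InΓ-neg : ∀ {X} → InΓ X → InΓ (neg³ X)
  InΓ-neg (inΓ L₂ L₃) = inΓ (Lin-neg a L₂) (Lin-neg b L₃)

  InΓ-sub : ∀ {X Y} → InΓ X → InΓ Y → InΓ (zipWith³ _-ℤ_ X Y)
  InΓ-sub (inΓ L₂ L₃) (inΓ L₂′ L₃′) = inΓ (Lin-sub a L₂ L₂′) (Lin-sub b L₃ L₃′)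

  InΓ-N∣ : ∀ {X} → (∀ i → N∣ coordℤ i X) → InΓ X
  InΓ-N∣ N∣X = inΓ (Lin-N∣-N∣ a (N∣X ax₁) (N∣X ax₂)) (Lin-N∣-N∣ b (N∣X ax₁) (N∣X ax₃))

  InΓ-N∣x₁ : ∀ {X} → InΓ X → N∣ coordℤ ax₁ X → ∀ j → N∣ coordℤ j X
  InΓ-N∣x₁ _ N∣x₁ ax₁ = N∣x₁
  InΓ-N∣x₁ (inΓ L₂ _) N∣x₁ ax₂ = Lin-N∣ a L₂ N∣x₁
  InΓ-N∣x₁ (inΓ _ L₃) N∣x₁ ax₃ = Lin-N∣ b L₃ N∣x₁

  InΓ-N∣coord : ∀ i {X} → InΓ X → N∣ coordℤ i X → ∀ j → N∣ coordℤ j X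
  InΓ-N∣coord ax₁ X∈ N∣x₁ = InΓ-N∣x₁ X∈ N∣x₁
  InΓ-N∣coord ax₂ X∈ N∣x₂ = InΓ-N∣x₁ X∈ (Lin-coprime a⊥N (InΓ.lin₂ X∈) N∣x₂)
  InΓ-N∣coord ax₃ X∈ N∣x₃ = InΓ-N∣x₁ X∈ (Lin-coprime b⊥N (InΓ.lin₃ X∈) N∣x₃)

  infix 4 _≡ᴺ_
  _≡ᴺ_ : ℤ³ → ℤ³ → Set
  X ≡ᴺ Y = ∀ i → N∣ (coordℤ i Y -ℤ coordℤ i X)

  InΓ-resp-≡ᴺ : ∀ {X U} → X ≡ᴺ U → InΓ X → InΓ U
  InΓ-resp-≡ᴺ X≡U (inΓ L₂ L₃) =
    inΓ (Lin-shift a L₂ (X≡U ax₁) (X≡U ax₂)) (Lin-shift b L₃ (X≡U ax₁) (X≡U ax₃))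

  ≡ᴺ-if-coord≡ : ∀ i {X Y} → InΓ X → InΓ Y → coordℤ i Y ≡ coordℤ i X → X ≡ᴺ Y
  ≡ᴺ-if-coord≡ i {X} {Y} X∈ Y∈ Yᵢ≡Xᵢ j =
    subst N∣_ (coordℤ-zipWith³ j _-ℤ_ Y X) (InΓ-N∣coord i (InΓ-sub Y∈ X∈) N∣Yᵢ-Xᵢ j)
    where
    N∣Yᵢ-Xᵢ : N∣ coordℤ i (zipWith³ _-ℤ_ Y X)
    N∣Yᵢ-Xᵢ = subst N∣_ (sym (trans (coordℤ-zipWith³ i _-ℤ_ Y X) (cong (_-ℤ coordℤ i X) Yᵢ≡Xᵢ)))
      (N∣i-i (coordℤ i X))

  minAbs-N∣ : ∀ {u v} → N∣ (v -ℤ u) → N∣ (minAbs u v -ℤ u)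
  minAbs-N∣ {u} {v} N∣v-u with minAbs-choice u v
  ... | inj₁ eq = subst (λ w → N∣ (w -ℤ u)) (sym eq) (N∣i-i u)
  ... | inj₂ eq = subst (λ w → N∣ (w -ℤ u)) (sym eq) N∣v-u

  ≡ᴺ-zipWith³-minAbs : ∀ {X Y} → X ≡ᴺ Y → X ≡ᴺ zipWith³ minAbs X Y
  ≡ᴺ-zipWith³-minAbs {X} {Y} X≡Y i =
    subst (λ w → N∣ (w -ℤ coordℤ i X)) (sym (coordℤ-zipWith³ i minAbs X Y))
      (minAbs-N∣ {coordℤ i X} {coordℤ i Y} (X≡Y i))

  sign-aligned : ∀ i {X Y} → InΓ Y → ∣ coordℤ i X ∣ ≡ ∣ coordℤ i Y ∣ →
                 ∃[ W ] InΓ W × absV W ≡ absV Y × coordℤ i W ≡ coordℤ i X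
  sign-aligned i {X} {Y} Y∈ ∣Xᵢ∣≡∣Yᵢ∣ with ∣i∣≡∣j∣⇒i≡±j (coordℤ i X) (coordℤ i Y) ∣Xᵢ∣≡∣Yᵢ∣
  ... | inj₁ Xᵢ≡Yᵢ = Y , Y∈ , refl , sym Xᵢ≡Yᵢ
  ... | inj₂ Xᵢ≡-Yᵢ = neg³ Y , InΓ-neg Y∈ , absV-neg³ Y , trans (coordℤ-neg³ i Y) (sym Xᵢ≡-Yᵢ)

  origin∉absΓ : ¬ absΓ a b N origin
  origin∉absΓ (_ , origin≢origin) = origin≢origin refl

  onAxis∈absΓ : 0 < N → ∀ i → absΓ a b N (onAxis i N)
  onAxis∈absΓ 0<N i =
    (toℤ³ (onAxis i N) , InΓ⇒Γ (InΓ-N∣ N∣coords) , refl) , onAxis≢origin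
    where
    onAxis≢origin : onAxis i N ≢ origin
    onAxis≢origin eq = ℕP.<⇒≢ 0<N (sym (begin
      N                     ≡⟨ coord-onAxis i N ⟨
      coord i (onAxis i N)  ≡⟨ cong (coord i) eq ⟩
      coord i origin        ≡⟨ coord-origin i ⟩
      0                     ∎))
      where open ≡-Reasoning
    N∣coords : ∀ j → N∣ coordℤ j (toℤ³ (onAxis i N))
    N∣coords j with j ≟ᵃ i
    ... | yes refl = subst N∣_ (sym (trans (coordℤ-toℤ³ i _) (cong +_ (coord-onAxis i N)))) ℤD.∣-refl
    ... | no j≢i = subst N∣_ (sym (trans (coordℤ-toℤ³ j _) (cong +_ (coord-onAxis-≢ N j≢i)))) N∣0

  inPlane⇒N∣ : ∀ i {γ} → absΓ a b N γ → coord i γ ≡ 0 → ∀ j → N ℕD.∣ coord j γ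
  inPlane⇒N∣ i ((X , X∈Γ , refl) , _) γᵢ≡0 j =
    subst (N ℕD.∣_) (sym (coord-absV j X)) (ℤD.∣⇒∣ᵤ (InΓ-N∣coord i (Γ⇒InΓ X∈Γ) N∣Xᵢ j))
    where
    N∣Xᵢ : N∣ coordℤ i X
    N∣Xᵢ = subst N∣_ (sym (ℤP.∣i∣≡0⇒i≡0 (trans (sym (coord-absV i X)) γᵢ≡0))) N∣0

  ⊓³∈absΓ : ∀ i {γ δ} → absΓ a b N γ → absΓ a b N δ →
            0 < coord i γ → coord i γ ≡ coord i δ → absΓ a b N (γ ⊓³ δ)
  ⊓³∈absΓ i ((X , X∈Γ , refl) , _) ((Y , Y∈Γ , refl) , _) 0<γᵢ γᵢ≡δᵢ
    with sign-aligned i (Γ⇒InΓ Y∈Γ) (trans (sym (coord-absV i X)) (trans γᵢ≡δᵢ (coord-absV i Y)))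
  ... | W , W∈ , ∣W∣≡∣Y∣ , Wᵢ≡Xᵢ =
    (zipWith³ minAbs X W , InΓ⇒Γ (InΓ-resp-≡ᴺ (≡ᴺ-zipWith³-minAbs X≡W) X∈) , ∣U∣≡γ⊓δ) ,
    ⊓³-≢origin i 0<γᵢ γᵢ≡δᵢ
    where
    X∈ = Γ⇒InΓ X∈Γ
    X≡W = ≡ᴺ-if-coord≡ i X∈ W∈ Wᵢ≡Xᵢ
    ∣U∣≡γ⊓δ = trans (absV-zipWith³-minAbs X W) (cong (absV X ⊓³_) ∣W∣≡∣Y∣)

  absΓ? : Decidable (absΓ a b N)
  absΓ? γ = lifts? γ ×-dec ¬? (γ ≟³ origin)
    where
    lifts? : ∀ γ → Dec (Σ ℤ³ λ X → Γ a b N X × absV X ≡ γ)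
    lifts? (γ₁ , γ₂ , γ₃) = map′ toLift fromLift
      (abs-preimage? _ (λ x₁ → abs-preimage? _ (λ x₂ → abs-preimage? _ (λ x₃ →
        InΓ? (x₁ , x₂ , x₃)) γ₃) γ₂) γ₁)
      where
      toLift : ∃[ x₁ ] ∣ x₁ ∣ ≡ γ₁ × ∃[ x₂ ] ∣ x₂ ∣ ≡ γ₂ × ∃[ x₃ ] ∣ x₃ ∣ ≡ γ₃ × InΓ (x₁ , x₂ , x₃) →
               Σ ℤ³ λ X → Γ a b N X × absV X ≡ (γ₁ , γ₂ , γ₃)
      toLift (x₁ , refl , x₂ , refl , x₃ , refl , X∈) = (x₁ , x₂ , x₃) , InΓ⇒Γ X∈ , refl
      fromLift : Σ ℤ³ (λ X → Γ a b N X × absV X ≡ (γ₁ , γ₂ , γ₃)) →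
                 ∃[ x₁ ] ∣ x₁ ∣ ≡ γ₁ × ∃[ x₂ ] ∣ x₂ ∣ ≡ γ₂ × ∃[ x₃ ] ∣ x₃ ∣ ≡ γ₃ × InΓ (x₁ , x₂ , x₃)
      fromLift ((x₁ , x₂ , x₃) , X∈Γ , refl) = x₁ , refl , x₂ , refl , x₃ , refl , Γ⇒InΓ X∈Γ

proposition4p3 : (a b N : ℕ) → 0 < a → 0 < b → 0 < N →
    Coprime a N → Coprime b N →
    Finite (vrm (absΓ a b N)) × Axial (vrm (absΓ a b N)) × GeneralPosition (vrm (absΓ a b N))
proposition4p3 a b N _ _ 0<N a⊥N b⊥N = finite , axial , generalPosition
  where
  open AbsLattice a b N a⊥N b⊥N
  open AxialMinima (absΓ a b N) N 0<N origin∉absΓ (onAxis∈absΓ 0<N) inPlane⇒N∣ ⊓³∈absΓ absΓ?
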